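{- Let $s,t \geq 1$ be integers and let $\beta_{s,t}$ be the type-$\beta$ comb with $s$ teeth of length $t$. Then the number of linear extensions of $\beta_{s,t}$ that avoid both patterns $213$ and $321$ equals $(s-1)(t-1)+1$.
   Context: A linear extension of a finite poset $P$ on a set of integers is a listing $v=[v_1,\dots,v_n]$ of all elements of $P$, each exactly once, such that whenever $a \leq_P b$, $a$ appears before $b$. For $w \in S_3$, a sequence $v$ of distinct integers contains $w$ if there are indices $i<j<k$ with $(v_i,v_j,v_k)$ in the same relative order as $(w_1,w_2,w_3)$; otherwise $v$ avoids $w$. The type-$\beta$ comb $\beta_{s,t}$ is the poset on $\{1,\dots,st\}$ whose order is generated by the relations $ct+1 \leq (c+1)t+1$ for $0 \leq c \leq s-2$ (the spine) and $ct+j \leq ct+j+1$ for $0 \leq c \leq s-1$, $1 \leq j \leq t-1$ (the teeth $\{ct+1,\dots,ct+t\}$). -}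

module Defs where

open import Data.Nat using (ℕ; zero; suc; _+_; _*_; _∸_; _≤_; _<_)
open import Data.List using (List; length; lookup; upTo; map)
open import Data.List.Relation.Binary.Permutation.Propositional using (_↭_)
open import Data.List.Relation.Unary.Unique.Propositional using (Unique)
open import Data.List.Membership.Propositional using (_∈_)
open import Data.Fin using (Fin; toℕ)
open import Data.Product using (Σ; ∃; _×_; _,_)
open import Data.Sum using (_⊎_)
open import Relation.Binary.PropositionalEquality using (_≡_)
open import Relation.Binary.Construct.Closure.ReflexiveTransitive using (Star)
open import Relation.Nullary using (¬_)
open import Function.Bundles using (_⇔_)

range1 : ℕ → List ℕ
range1 n = map suc (upTo n)

data CombGen (s t : ℕ) : ℕ → ℕ → Set where
  spine : (c : ℕ) → c + 2 ≤ s → CombGen s t (c * t + 1) (suc c * t + 1)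
  tooth : (c j : ℕ) → c < s → 1 ≤ j → j + 1 ≤ t →
          CombGen s t (c * t + j) (c * t + j + 1)

_≤β[_,_]_ : ℕ → ℕ → ℕ → ℕ → Set
a ≤β[ s , t ] b = Star (CombGen s t) a b

IsLinExt : ℕ → ℕ → List ℕ → Set
IsLinExt s t v =
  (v ↭ range1 (s * t)) ×
  (∀ a b → a ≤β[ s , t ] b → (i j : Fin (length v)) →
     lookup v i ≡ a → lookup v j ≡ b → toℕ i ≤ toℕ j)

SameOrder3 : ℕ → ℕ → ℕ → ℕ → ℕ → ℕ → Set
SameOrder3 x y z w1 w2 w3 =
  (x < y ⇔ w1 < w2) × (x < z ⇔ w1 < w3) × (y < z ⇔ w2 < w3)

Contains : List ℕ → ℕ → ℕ → ℕ → Set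
Contains v w1 w2 w3 =
  Σ (Fin (length v)) λ i → Σ (Fin (length v)) λ j → Σ (Fin (length v)) λ k →
    (toℕ i < toℕ j) × (toℕ j < toℕ k) ×
    SameOrder3 (lookup v i) (lookup v j) (lookup v k) w1 w2 w3

Avoids : List ℕ → ℕ → ℕ → ℕ → Set
Avoids v w1 w2 w3 = ¬ Contains v w1 w2 w3

Good : ℕ → ℕ → List ℕ → Set
Good s t v = IsLinExt s t v × Avoids v 2 1 3 × Avoids v 3 2 1

HasCount : (List ℕ → Set) → ℕ → Set
HasCount P n = Σ (List (List ℕ)) λ L → Unique L × (∀ v → (v ∈ L ⇔ P v)) × (length L ≡ n)

-- A permutation of 1, …, n avoids 213 and 321 exactly when it is a block swap
-- 1 … a, b+1 … n, a+1 … b: once the first value out of place, b+1, has appeared, any other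
-- continuation than b+2, …, n followed by a+1, …, b creates a 213 or a 321.
-- Such a block swap is a linear extension of β_{s,t} iff it is the identity or no edge of the
-- comb leaves the lower block a+1 … b. The tooth edge b → b+1 then forces b = (c+1)t, the spine
-- edge ct+1 → (c+1)t+1 forces a > ct, and b < st forces c+1 < s; conversely these conditions
-- suffice. Besides the identity there is thus one good extension for each c < s−1 and each a
-- strictly between ct and (c+1)t, which gives (s−1)(t−1)+1.

module Submission where

open import Defs
open import Data.Nat using (ℕ; zero; suc; _+_; _*_; _∸_; _≤_; _<_; z≤n; s≤s; z<s; s≤s⁻¹; NonZero)
open import Data.Nat.Properties
open import Data.Nat.DivMod using (_/_; _%_; m≡m%n+[m/n]*n; m%n<n)
open import Data.Nat.Divisibility using (_∣_; divides; _∣?_; m%n≡0⇒n∣m)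
open import Data.List using (List; []; _∷_; _++_; [_]; length; lookup; map; applyUpTo)
open import Data.List.Properties using (++-identityʳ; ++-assoc; length-++; length-map; map-upTo)
open import Data.List.Relation.Unary.Any as Any using (here; there; index)
open import Data.List.Relation.Unary.Any.Properties using (lookup-index)
import Data.List.Relation.Unary.All as All
open import Data.List.Relation.Unary.AllPairs as AllPairs using (AllPairs; []; _∷_)
import Data.List.Relation.Unary.AllPairs.Properties as AllPairs
open import Data.List.Membership.Propositional using (_∈_)
open import Data.List.Relation.Unary.Unique.Propositional using (Unique)
open import Data.List.Membership.Propositional.Properties using (∈-++⁺ˡ; ∈-++⁺ʳ; ∈-++⁻; ∈-map⁺; ∈-map⁻; ∈-lookup)
open import Data.List.Relation.Binary.Permutation.Propositional using (_↭_; ↭-sym; ↭-trans; ↭-reflexive)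
open import Data.List.Relation.Binary.Permutation.Propositional.Properties using (∈-resp-↭; drop-mid; drop-∷; ++⁺ˡ; ++-comm)
open import Data.Fin using (Fin; toℕ) renaming (zero to fzero; suc to fsuc)
open import Data.Product using (∃; ∃₂; _×_; _,_; proj₁; proj₂)
open import Data.Sum using (_⊎_; inj₁; inj₂)
open import Data.Empty using (⊥; ⊥-elim)
open import Function using (_∘_; _on_)
open import Function.Bundles using (_⇔_; mk⇔; Equivalence)
open import Function.Construct.Composition using (_⇔-∘_)
open import Function.Construct.Symmetry using (⇔-sym)
open import Relation.Nullary using (¬_; yes; no; contradiction)
open import Relation.Binary.PropositionalEquality hiding ([_])
open import Relation.Binary.Construct.Closure.ReflexiveTransitive using (Star; ε; _◅_; fold)

private
  variable
    A : Set
    xs ys : List A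
    i j lo k m a b d e l p s t c x y z s′ t′ : ℕ
    u v w : List ℕ
    w₁ w₂ w₃ : ℕ
    R : ℕ → ℕ → Set

interval : ℕ → ℕ → List ℕ
interval lo zero    = []
interval lo (suc k) = lo ∷ interval (suc lo) k

∈-interval⁻ : x ∈ interval lo k → lo ≤ x × x < lo + k
∈-interval⁻ {lo = lo} {k = suc k} (here refl) = ≤-refl , m<m+n lo z<s
∈-interval⁻ {x} {lo} {suc k} (there x∈) with ∈-interval⁻ x∈
... | lo<x , x<1+lo+k = <⇒≤ lo<x , subst (x <_) (sym (+-suc lo k)) x<1+lo+k

∈-interval⁺ : lo ≤ x → x < lo + k → x ∈ interval lo k
∈-interval⁺ {lo} {x} {zero} lo≤x x<lo+0 = ⊥-elim (<⇒≱ (subst (x <_) (+-identityʳ lo) x<lo+0) lo≤x)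
∈-interval⁺ {lo} {x} {suc k} lo≤x x<lo+k with m≤n⇒m<n∨m≡n lo≤x
... | inj₂ refl = here refl
... | inj₁ lo<x = there (∈-interval⁺ lo<x (subst (x <_) (+-suc lo k) x<lo+k))

∈-interval-split : x ∈ interval lo k → ∃₂ λ m e → x ≡ lo + m × k ≡ m + suc e
∈-interval-split {lo = lo} {k = suc k} (here refl) = 0 , k , sym (+-identityʳ lo) , refl
∈-interval-split {lo = lo} {k = suc k} (there x∈) with ∈-interval-split x∈
... | m , e , refl , refl = suc m , e , sym (+-suc lo m) , refl

interval-++ : ∀ lo a b → interval lo (a + b) ≡ interval lo a ++ interval (lo + a) b
interval-++ lo zero    b = cong (λ i → interval i b) (sym (+-identityʳ lo))
interval-++ lo (suc a) b = cong (lo ∷_) (begin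
  interval (suc lo) (a + b)                      ≡⟨ interval-++ (suc lo) a b ⟩
  interval (suc lo) a ++ interval (suc lo + a) b
    ≡⟨ cong (λ i → interval (suc lo) a ++ interval i b) (sym (+-suc lo a)) ⟩
  interval (suc lo) a ++ interval (lo + suc a) b ∎)
  where open ≡-Reasoning

length-interval : ∀ lo k → length (interval lo k) ≡ k
length-interval lo zero    = refl
length-interval lo (suc k) = cong suc (length-interval (suc lo) k)

applyUpTo-interval : ∀ {f} lo n → (∀ i → f i ≡ lo + i) → applyUpTo f n ≡ interval lo n
applyUpTo-interval lo zero    f≗ = refl
applyUpTo-interval lo (suc n) f≗ =
  cong₂ _∷_ (trans (f≗ 0) (+-identityʳ lo))
            (applyUpTo-interval (suc lo) n (λ i → trans (f≗ (suc i)) (+-suc lo i)))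

range1≡interval : ∀ n → range1 n ≡ interval 1 n
range1≡interval n = trans (map-upTo suc n) (applyUpTo-interval 1 n (λ _ → refl))

data Precedes {A : Set} : List A → A → A → Set where
  here  : ∀ {x y xs} → y ∈ xs → Precedes (x ∷ xs) x y
  there : ∀ {w x y xs} → Precedes xs x y → Precedes (w ∷ xs) x y

precedes⇒∈ˡ : {x y : A} → Precedes xs x y → x ∈ xs
precedes⇒∈ˡ (here _)  = here refl
precedes⇒∈ˡ (there p) = there (precedes⇒∈ˡ p)

precedes⇒∈ʳ : {x y : A} → Precedes xs x y → y ∈ xs
precedes⇒∈ʳ (here y∈) = there y∈
precedes⇒∈ʳ (there p) = there (precedes⇒∈ʳ p)

lookup-precedes : ∀ (xs : List A) (i j : Fin (length xs)) → toℕ i < toℕ j →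
                  Precedes xs (lookup xs i) (lookup xs j)
lookup-precedes (x ∷ xs) fzero    (fsuc j) _         = here (∈-lookup j)
lookup-precedes (x ∷ xs) (fsuc i) (fsuc j) (s≤s i<j) = there (lookup-precedes xs i j i<j)

precedes-lookup : {x y : A} → Precedes xs x y →
                  ∃₂ λ (i j : Fin (length xs)) → toℕ i < toℕ j × lookup xs i ≡ x × lookup xs j ≡ y
precedes-lookup (here y∈) = fzero , fsuc (index y∈) , z<s , refl , sym (lookup-index y∈)
precedes-lookup (there p) with precedes-lookup p
... | i , j , i<j , refl , refl = fsuc i , fsuc j , s≤s i<j , refl , refl

precedes-++ʳ : {x y : A} → ∀ xs → Precedes ys x y → Precedes (xs ++ ys) x y
precedes-++ʳ []       p = p
precedes-++ʳ (_ ∷ xs) p = there (precedes-++ʳ xs p)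

∈-++-precedes : {x y : A} → x ∈ xs → y ∈ ys → Precedes (xs ++ ys) x y
∈-++-precedes {xs = _ ∷ xs} (here refl) y∈ = here (∈-++⁺ʳ xs y∈)
∈-++-precedes (there x∈) y∈ = there (∈-++-precedes x∈ y∈)

precedes-++⁻ : {x y : A} → ∀ xs → Precedes (xs ++ ys) x y →
               Precedes xs x y ⊎ (x ∈ xs × y ∈ ys) ⊎ Precedes ys x y
precedes-++⁻ []       p = inj₂ (inj₂ p)
precedes-++⁻ (_ ∷ xs) (here y∈) with ∈-++⁻ xs y∈
... | inj₁ y∈xs = inj₁ (here y∈xs)
... | inj₂ y∈ys = inj₂ (inj₁ (here refl , y∈ys))
precedes-++⁻ (_ ∷ xs) (there p) with precedes-++⁻ xs p
... | inj₁ q             = inj₁ (there q)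
... | inj₂ (inj₁ (x∈ , y∈)) = inj₂ (inj₁ (there x∈ , y∈))
... | inj₂ (inj₂ q)      = inj₂ (inj₂ q)

precedes-total : {x y : A} → x ∈ xs → y ∈ xs → x ≢ y → Precedes xs x y ⊎ Precedes xs y x
precedes-total (here refl) (here refl) x≢y = contradiction refl x≢y
precedes-total (here refl) (there y∈) _    = inj₁ (here y∈)
precedes-total (there x∈) (here refl) _    = inj₂ (here x∈)
precedes-total (there x∈) (there y∈) x≢y with precedes-total x∈ y∈ x≢y
... | inj₁ p = inj₁ (there p)
... | inj₂ p = inj₂ (there p)

precedes⇒allPairs : {_~_ : A → A → Set} → (∀ {x y} → Precedes xs x y → x ~ y) → AllPairs _~_ xs
precedes⇒allPairs {xs = []}     _    = []
precedes⇒allPairs {xs = x ∷ xs} prec = All.tabulate (prec ∘ here) ∷ precedes⇒allPairs (prec ∘ there)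

interval-precedes : Precedes (interval lo k) x y → x < y
interval-precedes {k = suc k} (here y∈) = proj₁ (∈-interval⁻ y∈)
interval-precedes {k = suc k} (there p) = interval-precedes p

contains⇒precedes : Contains v w₁ w₂ w₃ →
  ∃₂ λ x y → ∃ λ z → Precedes v x y × Precedes v y z × SameOrder3 x y z w₁ w₂ w₃
contains⇒precedes {v} (i , j , k , i<j , j<k , so) =
  _ , _ , _ , lookup-precedes v i j i<j , lookup-precedes v j k j<k , so

∷-contains : Precedes v y z → SameOrder3 x y z w₁ w₂ w₃ → Contains (x ∷ v) w₁ w₂ w₃
∷-contains p so with precedes-lookup p
... | j , k , j<k , refl , refl = fzero , fsuc j , fsuc k , z<s , s≤s j<k , so

avoids-tail : Avoids (x ∷ v) w₁ w₂ w₃ → Avoids v w₁ w₂ w₃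
avoids-tail av (i , j , k , i<j , j<k , so) = av (fsuc i , fsuc j , fsuc k , s≤s i<j , s≤s j<k , so)

avoids-drop₂ : Avoids (x ∷ y ∷ v) w₁ w₂ w₃ → Avoids (x ∷ v) w₁ w₂ w₃
avoids-drop₂ av (fzero , fsuc j , fsuc k , _ , s≤s j<k , so) =
  av (fzero , fsuc (fsuc j) , fsuc (fsuc k) , z<s , s≤s (s≤s j<k) , so)
avoids-drop₂ av (fsuc i , fsuc j , fsuc k , s≤s i<j , s≤s j<k , so) =
  av (fsuc (fsuc i) , fsuc (fsuc j) , fsuc (fsuc k) , s≤s (s≤s i<j) , s≤s (s≤s j<k) , so)

sameOrder213 : y < x → x < z → SameOrder3 x y z 2 1 3
sameOrder213 y<x x<z =
  mk⇔ (λ x<y → contradiction y<x (<-asym x<y)) (λ { (s≤s ()) }) ,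
  mk⇔ (λ _ → ≤-refl) (λ _ → x<z) ,
  mk⇔ (λ _ → s≤s (s≤s z≤n)) (λ _ → <-trans y<x x<z)

sameOrder213⁻ : SameOrder3 x y z 2 1 3 → y ≤ x × x < z
sameOrder213⁻ (x<y⇔ , x<z⇔ , _) =
  ≮⇒≥ (λ x<y → contradiction (Equivalence.to x<y⇔ x<y) λ { (s≤s ()) }) , Equivalence.from x<z⇔ ≤-refl

sameOrder321 : z < y → y < x → SameOrder3 x y z 3 2 1
sameOrder321 z<y y<x =
  mk⇔ (λ x<y → contradiction y<x (<-asym x<y)) (λ { (s≤s (s≤s ())) }) ,
  mk⇔ (λ x<z → contradiction (<-trans z<y y<x) (<-asym x<z)) (λ { (s≤s ()) }) ,
  mk⇔ (λ y<z → contradiction z<y (<-asym y<z)) (λ { (s≤s ()) })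

sameOrder321⁻ : SameOrder3 x y z 3 2 1 → z ≤ y × y ≤ x
sameOrder321⁻ (x<y⇔ , _ , y<z⇔) =
  ≮⇒≥ (λ y<z → contradiction (Equivalence.to y<z⇔ y<z) λ { (s≤s ()) }) ,
  ≮⇒≥ (λ x<y → contradiction (Equivalence.to x<y⇔ x<y) λ { (s≤s (s≤s ())) })

Avoids213∧321 : List ℕ → Set
Avoids213∧321 v = Avoids v 2 1 3 × Avoids v 3 2 1

-- Permutations of an interval avoiding 213 and 321

blockSwap : ℕ → ℕ → ℕ → ℕ → List ℕ
blockSwap lo a d e = interval lo a ++ interval (lo + a + d) e ++ interval (lo + a) d

blockSwap-suc : ∀ lo a d e → blockSwap lo (suc a) d e ≡ lo ∷ blockSwap (suc lo) a d e
blockSwap-suc lo a d e rewrite +-suc lo a = refl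

blockSwap-zero : ∀ lo d e → blockSwap lo 0 d e ≡ interval (lo + d) e ++ interval lo d
blockSwap-zero lo d e rewrite +-identityʳ lo = refl

sorted-below-pivot : lo + k ≤ p → w ↭ interval lo k → Avoids (p ∷ w) 3 2 1 → w ≡ interval lo k
sorted-below-pivot {k = zero}  {w = []}    _ _ _ = refl
sorted-below-pivot {k = zero}  {w = y ∷ w} _ perm _ with () ← ∈-resp-↭ perm (here refl)
sorted-below-pivot {k = suc k} {w = []}    _ perm _ with () ← ∈-resp-↭ (↭-sym perm) (here refl)
sorted-below-pivot {lo} {suc k} {p} {y ∷ w} lo+k≤p perm av with ∈-resp-↭ perm (here refl)
... | here refl =
  cong (lo ∷_) (sorted-below-pivot (subst (_≤ p) (+-suc lo k) lo+k≤p) (drop-∷ perm) (avoids-drop₂ av))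
... | there y∈ with ∈-resp-↭ (↭-sym perm) (here refl)
...   | here lo≡y = ⊥-elim (<-irrefl lo≡y (proj₁ (∈-interval⁻ y∈)))
...   | there lo∈w = ⊥-elim (av (∷-contains (here lo∈w) (sameOrder321 (proj₁ (∈-interval⁻ y∈)) y<p)))
  where
  y<p : y < p
  y<p = <-≤-trans (subst (y <_) (sym (+-suc lo k)) (proj₂ (∈-interval⁻ y∈))) lo+k≤p

later-pair-forces-pattern : x < p → p < b → b < y → b ∈ w → x ∈ w → ¬ Avoids213∧321 (p ∷ y ∷ w)
later-pair-forces-pattern x<p p<b b<y b∈w x∈w (av213 , av321)
  with precedes-total b∈w x∈w (>⇒≢ (<-trans x<p p<b))
... | inj₁ b≺x = avoids-tail av321 (∷-contains b≺x (sameOrder321 (<-trans x<p p<b) b<y))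
... | inj₂ x≺b = av213 (∷-contains (there x≺b) (sameOrder213 x<p p<b))

swapped-around-pivot : lo + suc k ≤ p → p < b → w ↭ interval lo (suc k) ++ interval b l →
                       Avoids213∧321 (p ∷ w) → w ≡ interval b l ++ interval lo (suc k)
swapped-around-pivot {lo} {k} {w = w} {zero} lo+k≤p _ perm (_ , av321) =
  sorted-below-pivot lo+k≤p (subst (w ↭_) (++-identityʳ (interval lo (suc k))) perm) av321
swapped-around-pivot {lo} {k} {b = b} {w = []} {suc l} _ _ perm _
  with () ← ∈-resp-↭ (↭-sym perm) (∈-++⁺ʳ (interval lo (suc k)) (here refl))
swapped-around-pivot {lo} {k} {p} {b} {y ∷ w} {suc l} lo+k≤p p<b perm av@(av213 , av321)
  with ∈-++⁻ (interval lo (suc k)) (∈-resp-↭ perm (here refl))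
... | inj₁ y∈lower = ⊥-elim (av213 (∷-contains (here b∈w) (sameOrder213 y<p p<b)))
  where
  y<p : y < p
  y<p = <-≤-trans (proj₂ (∈-interval⁻ y∈lower)) lo+k≤p
  b∈w : b ∈ w
  b∈w = Any.tail (λ b≡y → <-asym p<b (subst (_< p) (sym b≡y) y<p))
                 (∈-resp-↭ (↭-sym perm) (∈-++⁺ʳ (interval lo (suc k)) (here refl)))
... | inj₂ (here refl) = cong (b ∷_)
  (swapped-around-pivot lo+k≤p (<-trans p<b (n<1+n b)) (drop-mid [] (interval lo (suc k)) perm)
                        (avoids-drop₂ av213 , avoids-drop₂ av321))
... | inj₂ (there y∈upper) = ⊥-elim (later-pair-forces-pattern lo<p p<b b<y b∈w lo∈w av)
  where
  b<y : b < y
  b<y = proj₁ (∈-interval⁻ y∈upper)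
  lo<p : lo < p
  lo<p = <-≤-trans (m<m+n lo z<s) lo+k≤p
  ∈w : ∀ {x} → x < y → x ∈ interval lo (suc k) ++ interval b (suc l) → x ∈ w
  ∈w x<y x∈ = Any.tail (λ x≡y → <-irrefl x≡y x<y) (∈-resp-↭ (↭-sym perm) x∈)
  b∈w : b ∈ w
  b∈w = ∈w b<y (∈-++⁺ʳ (interval lo (suc k)) (here refl))
  lo∈w : lo ∈ w
  lo∈w = ∈w (<-trans (<-trans lo<p p<b) b<y) (here refl)

avoider≡blockSwap : v ↭ interval lo k → Avoids213∧321 v →
                    ∃₂ λ a d → ∃ λ e → a + d + e ≡ k × v ≡ blockSwap lo a d e
avoider≡blockSwap {[]}    {k = zero}  _    _ = 0 , 0 , 0 , refl , refl
avoider≡blockSwap {[]}    {k = suc k} perm _ with () ← ∈-resp-↭ (↭-sym perm) (here refl)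
avoider≡blockSwap {x ∷ v} {k = zero}  perm _ with () ← ∈-resp-↭ perm (here refl)
avoider≡blockSwap {x ∷ v} {lo} {suc k} perm av@(av213 , av321) with ∈-resp-↭ perm (here refl)
... | here refl with avoider≡blockSwap (drop-∷ perm) (avoids-tail av213 , avoids-tail av321)
...   | a , d , e , refl , refl = suc a , d , e , refl , sym (blockSwap-suc lo a d e)
avoider≡blockSwap {x ∷ v} {lo} {suc k} perm av | there x∈ with ∈-interval-split x∈
...   | m , e , refl , refl = 0 , suc m , suc e , refl , (begin
  x ∷ v
    ≡⟨ cong (x ∷_) v≡ ⟩
  interval x (suc e) ++ interval lo (suc m)
    ≡⟨ cong (λ i → interval i (suc e) ++ interval lo (suc m)) (+-suc lo m) ⟨
  interval (lo + suc m) (suc e) ++ interval lo (suc m)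
    ≡⟨ blockSwap-zero lo (suc m) (suc e) ⟨
  blockSwap lo 0 (suc m) (suc e)
    ∎)
  where
  open ≡-Reasoning
  perm′ : x ∷ v ↭ interval lo (suc m) ++ x ∷ interval (suc x) e
  perm′ = subst (x ∷ v ↭_) (trans (interval-++ lo (suc m) (suc e))
                                  (cong (λ i → interval lo (suc m) ++ interval i (suc e)) (+-suc lo m))) perm
  v≡ : v ≡ interval (suc x) e ++ interval lo (suc m)
  v≡ = swapped-around-pivot (≤-reflexive (+-suc lo m)) (n<1+n x) (drop-mid [] (interval lo (suc m)) perm′) av

blockSwap-↭ : ∀ lo a d e → blockSwap lo a d e ↭ interval lo (a + d + e)
blockSwap-↭ lo a d e =
  ↭-trans (++⁺ˡ (interval lo a) (++-comm (interval (lo + a + d) e) (interval (lo + a) d)))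
          (↭-reflexive (sym interval≡))
  where
  open ≡-Reasoning
  interval≡ : interval lo (a + d + e) ≡ interval lo a ++ interval (lo + a) d ++ interval (lo + a + d) e
  interval≡ = begin
    interval lo (a + d + e)
      ≡⟨ interval-++ lo (a + d) e ⟩
    interval lo (a + d) ++ interval (lo + (a + d)) e
      ≡⟨ cong₂ _++_ (interval-++ lo a d) (cong (λ i → interval i e) (sym (+-assoc lo a d))) ⟩
    (interval lo a ++ interval (lo + a) d) ++ interval (lo + a + d) e
      ≡⟨ ++-assoc (interval lo a) _ _ ⟩
    interval lo a ++ interval (lo + a) d ++ interval (lo + a + d) e
      ∎

blockSwap-no-lower : ∀ lo a e → blockSwap lo a 0 e ≡ interval lo (a + 0 + e)
blockSwap-no-lower lo a e
  rewrite +-identityʳ a | +-identityʳ (lo + a) | ++-identityʳ (interval (lo + a) e) = sym (interval-++ lo a e)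

blockSwap-no-upper : ∀ lo a d → blockSwap lo a d 0 ≡ interval lo (a + d + 0)
blockSwap-no-upper lo a d rewrite +-identityʳ (a + d) = sym (interval-++ lo a d)

blockSwap-precedes : Precedes (blockSwap lo a d e) x y →
                     x < y ⊎ (lo + a + d ≤ x × lo + a ≤ y × y < lo + a + d)
blockSwap-precedes {lo} {a} {d} {e} x≺y with precedes-++⁻ (interval lo a) x≺y
... | inj₁ x≺y′ = inj₁ (interval-precedes x≺y′)
... | inj₂ (inj₁ (x∈ , y∈)) = inj₁ (<-≤-trans (proj₂ (∈-interval⁻ x∈)) (lo+a≤ y∈))
  where
  lo+a≤ : y ∈ interval (lo + a + d) e ++ interval (lo + a) d → lo + a ≤ y
  lo+a≤ y∈ with ∈-++⁻ (interval (lo + a + d) e) y∈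
  ... | inj₁ y∈upper = ≤-trans (m≤m+n (lo + a) d) (proj₁ (∈-interval⁻ y∈upper))
  ... | inj₂ y∈lower = proj₁ (∈-interval⁻ y∈lower)
... | inj₂ (inj₂ x≺y′) with precedes-++⁻ (interval (lo + a + d) e) x≺y′
...   | inj₁ x≺y″ = inj₁ (interval-precedes x≺y″)
...   | inj₂ (inj₁ (x∈ , y∈)) = inj₂ (proj₁ (∈-interval⁻ x∈) , ∈-interval⁻ y∈)
...   | inj₂ (inj₂ x≺y″) = inj₁ (interval-precedes x≺y″)

blockSwap-precedes-lower : Precedes (blockSwap lo a d e) x y → lo + a ≤ x → x < lo + a + d → y < lo + a + d
blockSwap-precedes-lower {lo} {a} {d} {e} x≺y lo+a≤x x<lo+a+d with precedes-++⁻ (interval lo a) x≺y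
... | inj₁ x≺y′       = contradiction (proj₂ (∈-interval⁻ (precedes⇒∈ˡ x≺y′))) (≤⇒≯ lo+a≤x)
... | inj₂ (inj₁ (x∈ , _)) = contradiction (proj₂ (∈-interval⁻ x∈)) (≤⇒≯ lo+a≤x)
... | inj₂ (inj₂ x≺y′) with precedes-++⁻ (interval (lo + a + d) e) x≺y′
...   | inj₁ x≺y″       = contradiction (proj₁ (∈-interval⁻ (precedes⇒∈ˡ x≺y″))) (<⇒≱ x<lo+a+d)
...   | inj₂ (inj₁ (x∈ , _)) = contradiction (proj₁ (∈-interval⁻ x∈)) (<⇒≱ x<lo+a+d)
...   | inj₂ (inj₂ x≺y″) = proj₂ (∈-interval⁻ (precedes⇒∈ʳ x≺y″))

blockSwap-avoids213 : Avoids (blockSwap lo a d e) 2 1 3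
blockSwap-avoids213 {lo} {a} {d} {e} c with contains⇒precedes {blockSwap lo a d e} c
... | x , y , z , x≺y , y≺z , so with sameOrder213⁻ so | blockSwap-precedes {lo} {a} {d} {e} x≺y
...   | y≤x , x<z | inj₁ x<y = <⇒≱ x<y y≤x
...   | y≤x , x<z | inj₂ (cut≤x , lo+a≤y , y<cut) =
  <⇒≱ x<z (≤-trans (<⇒≤ (blockSwap-precedes-lower {lo} {a} {d} {e} y≺z lo+a≤y y<cut)) cut≤x)

blockSwap-avoids321 : Avoids (blockSwap lo a d e) 3 2 1
blockSwap-avoids321 {lo} {a} {d} {e} c with contains⇒precedes {blockSwap lo a d e} c
... | x , y , z , x≺y , y≺z , so
    with sameOrder321⁻ so | blockSwap-precedes {lo} {a} {d} {e} x≺y | blockSwap-precedes {lo} {a} {d} {e} y≺z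
...   | _ , y≤x | inj₁ x<y | _ = <⇒≱ x<y y≤x
...   | z≤y , _ | _ | inj₁ y<z = <⇒≱ y<z z≤y
...   | _ | inj₂ (_ , _ , y<cut) | inj₂ (cut≤y , _) = <⇒≱ y<cut cut≤y

Respects : (ℕ → ℕ → Set) → List ℕ → Set
Respects R v = ∀ x y → R x y → (i j : Fin (length v)) →
               lookup v i ≡ x → lookup v j ≡ y → toℕ i ≤ toℕ j

respects⁺ : (∀ {x y} → R x y → ¬ Precedes v y x) → Respects R v
respects⁺ {v = v} no-inversion x y xRy i j refl refl =
  ≮⇒≥ (λ j<i → no-inversion xRy (lookup-precedes v j i j<i))

respects⁻ : Respects R v → R x y → ¬ Precedes v y x
respects⁻ resp xRy y≺x with precedes-lookup y≺x
... | i , j , i<j , refl , refl = <⇒≱ i<j (resp _ _ xRy j i refl refl)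

UpClosed : (ℕ → ℕ → Set) → ℕ → ℕ → Set
UpClosed R i j = ∀ {u u′} → R u u′ → i ≤ u → u < j → u′ < j

upClosed-empty : j ≤ i → UpClosed R i j
upClosed-empty j≤i _ i≤u u<j = contradiction (<-≤-trans u<j j≤i) (≤⇒≯ i≤u)

star-upClosed : (∀ {u u′} → R u u′ → u ≤ u′) → UpClosed R i j → UpClosed (Star R) i j
star-upClosed mono closed ε          i≤u u<j = u<j
star-upClosed mono closed (r ◅ rs) i≤u u<j =
  star-upClosed mono closed rs (≤-trans i≤u (mono r)) (closed r i≤u u<j)

blockSwap-respects : (∀ {u u′} → R u u′ → u ≤ u′) → UpClosed R (lo + a) (lo + a + d) →
                     Respects (Star R) (blockSwap lo a d e)
blockSwap-respects {R} {lo} {a} {d} {e} mono closed = respects⁺ no-inversion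
  where
  no-inversion : Star R x y → ¬ Precedes (blockSwap lo a d e) y x
  no-inversion x⇝y y≺x with blockSwap-precedes {lo} {a} {d} {e} y≺x
  ... | inj₁ y<x = <⇒≱ y<x (fold _≤_ (≤-trans ∘ mono) ≤-refl x⇝y)
  ... | inj₂ (cut≤y , lo+a≤x , x<cut) = <⇒≱ (star-upClosed mono closed x⇝y lo+a≤x x<cut) cut≤y

-- Block swaps that are linear extensions of the comb

combGen-increasing : CombGen s t x y → x ≤ y
combGen-increasing {t = t} (spine c _)       = +-monoˡ-≤ 1 (m≤n+m (c * t) t)
combGen-increasing         (tooth c j _ _ _) = m≤m+n _ 1

no-multiple-strictly-between : c * t < m * t → m * t < suc c * t → ⊥
no-multiple-strictly-between {c} {t} {m} ct<mt mt<ct+t =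
  <⇒≱ (*-cancelʳ-< t c m ct<mt) (s≤s⁻¹ (*-cancelʳ-< t m (suc c) mt<ct+t))

comb-upClosed : c * t < a → UpClosed (CombGen s t) (suc a) (suc (suc c * t))
comb-upClosed {c} {t} {a} ct<a (spine c′ _) a<u u≤ =
  contradiction (≤-trans a≤c′t (*-monoˡ-≤ t (s≤s⁻¹ c′<1+c))) (<⇒≱ ct<a)
  where
  c′<1+c : c′ < suc c
  c′<1+c = *-cancelʳ-< t c′ (suc c) (subst (_≤ suc c * t) (+-comm (c′ * t) 1) (s≤s⁻¹ u≤))
  a≤c′t : a ≤ c′ * t
  a≤c′t = s≤s⁻¹ (subst (suc a ≤_) (+-comm (c′ * t) 1) a<u)
comb-upClosed {c} {t} {a} _ (tooth c′ j _ 1≤j j+1≤t) _ u≤ with m≤n⇒m<n∨m≡n (s≤s⁻¹ u≤)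
... | inj₁ u<ct+t = s≤s (subst (_≤ suc c * t) (+-comm 1 (c′ * t + j)) u<ct+t)
... | inj₂ u≡ct+t = ⊥-elim (no-multiple-strictly-between {c′} {t} {suc c}
        (subst (c′ * t <_) u≡ct+t (m<m+n (c′ * t) 1≤j))
        (subst (_< suc c′ * t) u≡ct+t (subst (c′ * t + j <_) (+-comm (c′ * t) t) (+-monoʳ-< (c′ * t) j<t))))
  where
  j<t : j < t
  j<t = subst (_≤ t) (+-comm j 1) j+1≤t

comb-tooth : .{{_ : NonZero t}} → x < s * t → ¬ t ∣ x → CombGen s t x (suc x)
comb-tooth {t} {x} {s} x<st t∤x =
  subst₂ (CombGen s t) qt+r≡x (trans (cong (_+ 1) qt+r≡x) (+-comm x 1)) (tooth q r q<s 1≤r r+1≤t)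
  where
  q r : ℕ
  q = x / t
  r = x % t
  qt+r≡x : q * t + r ≡ x
  qt+r≡x = trans (+-comm (q * t) r) (sym (m≡m%n+[m/n]*n x t))
  1≤r : 1 ≤ r
  1≤r = n≢0⇒n>0 (t∤x ∘ m%n≡0⇒n∣m x t)
  q<s : q < s
  q<s = *-cancelʳ-< t q s (≤-<-trans (subst (q * t ≤_) qt+r≡x (m≤m+n (q * t) r)) x<st)
  r+1≤t : r + 1 ≤ t
  r+1≤t = subst (_≤ t) (+-comm 1 r) (m%n<n x t)

CombCut : ℕ → ℕ → ℕ → ℕ → Set
CombCut s t c a = c * t < a × a < suc c * t × suc c < s

-- The upper block starts with top + 1 and precedes the whole lower block, so no comb edge may
-- lead from the lower block to top + 1.
module _ {s t a d e : ℕ} .{{_ : NonZero t}}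
         (sum : a + suc d + suc e ≡ s * t)
         (resp : Respects (_≤β[ s , t ]_) (blockSwap 1 a (suc d) (suc e))) where

  private
    top : ℕ
    top = a + suc d

    top<st : top < s * t
    top<st = subst (top <_) sum (m<m+n top z<s)

    no-edge-into-upper : x ∈ interval (suc a) (suc d) → ¬ CombGen s t x (suc top)
    no-edge-into-upper x∈ g =
      respects⁻ resp (g ◅ ε) (precedes-++ʳ (interval 1 a) (∈-++-precedes (here refl) x∈))

    top∈lower : top ∈ interval (suc a) (suc d)
    top∈lower = ∈-interval⁺ (≤-trans (s≤s (m≤m+n a d)) (≤-reflexive (sym (+-suc a d)))) (n<1+n top)

  linExt-blockSwap⇒combCut : ∃ λ c → a + suc d ≡ suc c * t × CombCut s t c a
  linExt-blockSwap⇒combCut with t ∣? top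
  ... | no t∤top = ⊥-elim (no-edge-into-upper top∈lower (comb-tooth top<st t∤top))
  ... | yes (divides zero top≡0) = ⊥-elim (m+1+n≢0 a top≡0)
  ... | yes (divides (suc c) top≡ct+t) with c * t <? a
  ...   | yes ct<a = c , top≡ct+t , ct<a , subst (a <_) top≡ct+t (m<m+n a z<s) ,
                     *-cancelʳ-< t (suc c) s (subst (_< s * t) top≡ct+t top<st)
  ...   | no ct≮a = ⊥-elim (no-edge-into-upper ct+1∈lower
                             (subst₂ (CombGen s t) (+-comm (c * t) 1) ct+t+1≡top+1 (spine c c+2≤s)))
    where
    ct+t+1≡top+1 : suc c * t + 1 ≡ suc top
    ct+t+1≡top+1 = trans (+-comm (suc c * t) 1) (cong suc (sym top≡ct+t))
    c+2≤s : c + 2 ≤ s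
    c+2≤s = subst (_≤ s) (+-comm 2 c) (*-cancelʳ-< t (suc c) s (subst (_< s * t) top≡ct+t top<st))
    ct+1∈lower : suc (c * t) ∈ interval (suc a) (suc d)
    ct+1∈lower = ∈-interval⁺ (s≤s (≮⇒≥ ct≮a))
                             (s≤s (subst (c * t <_) (sym top≡ct+t) (*-monoˡ-< t (n<1+n c))))

combSwap : ℕ → ℕ → ℕ → ℕ → List ℕ
combSwap s t c a = blockSwap 1 a (suc c * t ∸ a) (s * t ∸ suc c * t)

GoodForm : ℕ → ℕ → List ℕ → Set
GoodForm s t v = v ≡ interval 1 (s * t) ⊎ ∃₂ λ c a → CombCut s t c a × v ≡ combSwap s t c a

blockSwap-good : a + d + e ≡ s * t → UpClosed (CombGen s t) (suc a) (suc (a + d)) →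
                 Good s t (blockSwap 1 a d e)
blockSwap-good {a} {d} {e} {s} {t} sum closed =
  (↭-trans (blockSwap-↭ 1 a d e) (↭-reflexive (trans (cong (interval 1) sum) (sym (range1≡interval (s * t))))) ,
   blockSwap-respects {CombGen s t} {1} {a} {d} {e} combGen-increasing closed) ,
  blockSwap-avoids213 {1} {a} {d} {e} , blockSwap-avoids321 {1} {a} {d} {e}

identity-good : Good s t (interval 1 (s * t))
identity-good {s} {t} = subst (Good s t) (++-identityʳ (interval 1 (s * t)))
  (blockSwap-good (trans (+-identityʳ _) (+-identityʳ _))
                  (upClosed-empty {R = CombGen s t} (≤-reflexive (cong suc (+-identityʳ (s * t))))))

combSwap-good : CombCut s t c a → Good s t (combSwap s t c a)
combSwap-good {s} {t} {c} {a} (ct<a , a<ct+t , c+1<s) =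
  blockSwap-good sum (subst (UpClosed (CombGen s t) (suc a)) (cong suc (sym a+d≡)) (comb-upClosed {c} ct<a))
  where
  a+d≡ : a + (suc c * t ∸ a) ≡ suc c * t
  a+d≡ = m+[n∸m]≡n (<⇒≤ a<ct+t)
  sum : a + (suc c * t ∸ a) + (s * t ∸ suc c * t) ≡ s * t
  sum = trans (cong (_+ (s * t ∸ suc c * t)) a+d≡) (m+[n∸m]≡n (*-monoˡ-≤ t (<⇒≤ c+1<s)))

good⇒goodForm : .{{_ : NonZero t}} → Good s t v → GoodForm s t v
good⇒goodForm {t} {s} {v} ((perm , resp) , av)
  with avoider≡blockSwap (subst (v ↭_) (range1≡interval (s * t)) perm) av
... | a , zero  , e     , sum , refl = inj₁ (trans (blockSwap-no-lower 1 a e) (cong (interval 1) sum))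
... | a , suc d , zero  , sum , refl = inj₁ (trans (blockSwap-no-upper 1 a (suc d)) (cong (interval 1) sum))
... | a , suc d , suc e , sum , refl with linExt-blockSwap⇒combCut sum resp
...   | c , top≡ , cut = inj₂ (c , a , cut , cong₂ (blockSwap 1 a) d≡ e≡)
  where
  d≡ : suc d ≡ suc c * t ∸ a
  d≡ = trans (sym (m+n∸m≡n a (suc d))) (cong (_∸ a) top≡)
  e≡ : suc e ≡ s * t ∸ suc c * t
  e≡ = trans (sym (m+n∸m≡n (a + suc d) (suc e))) (cong₂ _∸_ sum top≡)

good⇔goodForm : .{{_ : NonZero t}} → Good s t v ⇔ GoodForm s t v
good⇔goodForm = mk⇔ good⇒goodForm λ where
  (inj₁ refl)                → identity-good
  (inj₂ (c , a , cut , refl)) → combSwap-good cut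

-- Enumeration and count

row : ℕ → ℕ → ℕ → List (List ℕ)
row s t c = map (combSwap s t c) (interval (suc (c * t)) (t ∸ 1))

rows : ℕ → ℕ → ℕ → List (List ℕ)
rows s t zero    = []
rows s t (suc c) = rows s t c ++ row s t c

goodExtensions : ℕ → ℕ → List (List ℕ)
goodExtensions s t = rows s t (s ∸ 1) ++ [ interval 1 (s * t) ]

length-rows : ∀ s t m → length (rows s t m) ≡ m * (t ∸ 1)
length-rows s t zero    = refl
length-rows s t (suc m) = begin
  length (rows s t m ++ row s t m)         ≡⟨ length-++ (rows s t m) ⟩
  length (rows s t m) + length (row s t m) ≡⟨ cong₂ _+_ (length-rows s t m) length-row ⟩
  m * (t ∸ 1) + (t ∸ 1)                    ≡⟨ +-comm (m * (t ∸ 1)) (t ∸ 1) ⟩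
  suc m * (t ∸ 1)                          ∎
  where
  open ≡-Reasoning
  length-row : length (row s t m) ≡ t ∸ 1
  length-row = trans (length-map (combSwap s t m) (interval (suc (m * t)) (t ∸ 1)))
                     (length-interval (suc (m * t)) (t ∸ 1))

length-goodExtensions : ∀ s t → length (goodExtensions s t) ≡ (s ∸ 1) * (t ∸ 1) + 1
length-goodExtensions s t = trans (length-++ (rows s t (s ∸ 1))) (cong (_+ 1) (length-rows s t (s ∸ 1)))

∈-rows⁻ : v ∈ rows s t m →
          ∃₂ λ c a → c < m × a ∈ interval (suc (c * t)) (t ∸ 1) × v ≡ combSwap s t c a
∈-rows⁻ {s = s} {t} {suc m} v∈ with ∈-++⁻ (rows s t m) v∈
... | inj₁ v∈rows with ∈-rows⁻ v∈rows
...   | c , a , c<m , a∈ , v≡ = c , a , m<n⇒m<1+n c<m , a∈ , v≡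
∈-rows⁻ {s = s} {t} {suc m} v∈ | inj₂ v∈row with ∈-map⁻ (combSwap s t m) v∈row
...   | a , a∈ , v≡ = m , a , n<1+n m , a∈ , v≡

∈-rows⁺ : c < m → a ∈ interval (suc (c * t)) (t ∸ 1) → combSwap s t c a ∈ rows s t m
∈-rows⁺ {c} {suc m} {t = t} {s} c<1+m a∈ with m≤n⇒m<n∨m≡n (s≤s⁻¹ c<1+m)
... | inj₁ c<m  = ∈-++⁺ˡ (∈-rows⁺ c<m a∈)
... | inj₂ refl = ∈-++⁺ʳ (rows s t c) (∈-map⁺ (combSwap s t c) a∈)

∈-row⇔combCut : c < s′ → a ∈ interval (suc (c * suc t′)) t′ ⇔ CombCut (suc s′) (suc t′) c a
∈-row⇔combCut {c} {s′} {a} {t′} c<s′ = mk⇔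
  (λ a∈ → proj₁ (∈-interval⁻ a∈) , subst (a <_) row-end (proj₂ (∈-interval⁻ a∈)) , s≤s c<s′)
  (λ (ct<a , a<ct+t , _) → ∈-interval⁺ ct<a (subst (a <_) (sym row-end) a<ct+t))
  where
  row-end : suc (c * suc t′) + t′ ≡ suc c * suc t′
  row-end = cong suc (+-comm (c * suc t′) t′)

∈-goodExtensions⇔ : v ∈ goodExtensions (suc s′) (suc t′) ⇔ GoodForm (suc s′) (suc t′) v
∈-goodExtensions⇔ {v} {s′} {t′} = mk⇔ to from
  where
  to : v ∈ goodExtensions (suc s′) (suc t′) → GoodForm (suc s′) (suc t′) v
  to v∈ with ∈-++⁻ (rows (suc s′) (suc t′) s′) v∈
  ... | inj₁ v∈rows with ∈-rows⁻ v∈rows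
  ...   | c , a , c<s′ , a∈ , v≡ = inj₂ (c , a , Equivalence.to (∈-row⇔combCut c<s′) a∈ , v≡)
  to v∈ | inj₂ (here v≡) = inj₁ v≡
  from : GoodForm (suc s′) (suc t′) v → v ∈ goodExtensions (suc s′) (suc t′)
  from (inj₁ refl) = ∈-++⁺ʳ (rows (suc s′) (suc t′) s′) (here refl)
  from (inj₂ (c , a , cut@(_ , _ , c+1<s) , refl)) =
    ∈-++⁺ˡ (∈-rows⁺ (s≤s⁻¹ c+1<s) (Equivalence.from (∈-row⇔combCut (s≤s⁻¹ c+1<s)) cut))

-- Distinctness: the cut a is recovered as the length of the initial run 1, 2, …, a

prefixLength : ℕ → List ℕ → ℕ
prefixLength lo []      = 0
prefixLength lo (x ∷ v) with x ≟ lo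
... | yes _ = suc (prefixLength (suc lo) v)
... | no  _ = 0

prefixLength-interval : ∀ lo n → prefixLength lo (interval lo n) ≡ n
prefixLength-interval lo zero    = refl
prefixLength-interval lo (suc n) rewrite ≟-diag (refl {x = lo}) = cong suc (prefixLength-interval (suc lo) n)

prefixLength-interval-++ : ∀ lo a → x ≢ lo + a → prefixLength lo (interval lo a ++ x ∷ v) ≡ a
prefixLength-interval-++ {x} lo zero x≢lo+0 with x ≟ lo
... | yes x≡lo = contradiction (trans x≡lo (sym (+-identityʳ lo))) x≢lo+0
... | no  _    = refl
prefixLength-interval-++ lo (suc a) x≢lo+a+1 rewrite ≟-diag (refl {x = lo}) =
  cong suc (prefixLength-interval-++ (suc lo) a (λ x≡ → x≢lo+a+1 (trans x≡ (sym (+-suc lo a)))))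

prefixLength-blockSwap : 0 < d → 0 < e → prefixLength lo (blockSwap lo a d e) ≡ a
prefixLength-blockSwap {d = suc d} {e = suc e} {lo} {a} _ _ = prefixLength-interval-++ lo a (m+1+n≢m (lo + a))

prefixLength-combSwap : .{{_ : NonZero t}} → CombCut s t c a → prefixLength 1 (combSwap s t c a) ≡ a
prefixLength-combSwap {t} (_ , a<ct+t , c+1<s) =
  prefixLength-blockSwap (m<n⇒0<n∸m a<ct+t) (m<n⇒0<n∸m (*-monoˡ-< t c+1<s))

rows-bounded : m ≤ s′ → u ∈ rows (suc s′) (suc t′) m → prefixLength 1 u < m * suc t′
rows-bounded {m} {s′} {t′ = t′} m≤s′ u∈ with ∈-rows⁻ {s = suc s′} {t = suc t′} u∈
... | c , a , c<m , a∈ , refl = begin-strict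
  prefixLength 1 (combSwap (suc s′) (suc t′) c a) ≡⟨ prefixLength-combSwap cut ⟩
  a                                               <⟨ proj₁ (proj₂ cut) ⟩
  suc c * suc t′                                  ≤⟨ *-monoˡ-≤ (suc t′) c<m ⟩
  m * suc t′                                      ∎
  where
  open ≤-Reasoning
  cut : CombCut (suc s′) (suc t′) c a
  cut = Equivalence.to (∈-row⇔combCut (<-≤-trans c<m m≤s′)) a∈

row-bounded : m < s′ → u ∈ row (suc s′) (suc t′) m → m * suc t′ < prefixLength 1 u
row-bounded {m} {s′} {t′ = t′} m<s′ u∈ with ∈-map⁻ (combSwap (suc s′) (suc t′) m) u∈
... | a , a∈ , refl = subst (m * suc t′ <_) (sym (prefixLength-combSwap cut)) (proj₁ cut)
  where
  cut : CombCut (suc s′) (suc t′) m a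
  cut = Equivalence.to (∈-row⇔combCut m<s′) a∈

row-sorted : m < s′ → AllPairs (_<_ on prefixLength 1) (row (suc s′) (suc t′) m)
row-sorted {m} {s′} {t′} m<s′ = AllPairs.map⁺ (precedes⇒allPairs λ a≺a′ →
  subst₂ _<_ (sym (prefixLength-combSwap (cut (precedes⇒∈ˡ a≺a′))))
             (sym (prefixLength-combSwap (cut (precedes⇒∈ʳ a≺a′))))
             (interval-precedes a≺a′))
  where
  cut : a ∈ interval (suc (m * suc t′)) t′ → CombCut (suc s′) (suc t′) m a
  cut = Equivalence.to (∈-row⇔combCut m<s′)

rows-sorted : m ≤ s′ → AllPairs (_<_ on prefixLength 1) (rows (suc s′) (suc t′) m)
rows-sorted {zero}  _      = []
rows-sorted {suc m} m+1≤s′ = AllPairs.++⁺ (rows-sorted (<⇒≤ m+1≤s′)) (row-sorted m+1≤s′)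
  (All.tabulate λ u∈ → All.tabulate λ w∈ →
    <-trans (rows-bounded (<⇒≤ m+1≤s′) u∈) (row-bounded m+1≤s′ w∈))

goodExtensions-sorted : ∀ s′ t′ → AllPairs (_<_ on prefixLength 1) (goodExtensions (suc s′) (suc t′))
goodExtensions-sorted s′ t′ =
  AllPairs.++⁺ (rows-sorted {m = s′} {t′ = t′} ≤-refl) (All.[] ∷ [])
               (All.tabulate λ u∈ → below-identity u∈ All.∷ All.[])
  where
  open ≤-Reasoning
  below-identity : u ∈ rows (suc s′) (suc t′) s′ →
                   prefixLength 1 u < prefixLength 1 (interval 1 (suc s′ * suc t′))
  below-identity {u} u∈ = begin-strict
    prefixLength 1 u                              <⟨ rows-bounded {m = s′} {t′ = t′} ≤-refl u∈ ⟩
    s′ * suc t′                                   ≤⟨ *-monoˡ-≤ (suc t′) (n≤1+n s′) ⟩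
    suc s′ * suc t′                               ≡⟨ prefixLength-interval 1 (suc s′ * suc t′) ⟨
    prefixLength 1 (interval 1 (suc s′ * suc t′)) ∎

increasing⇒unique : ∀ {f : List ℕ → ℕ} {us} → AllPairs (_<_ on f) us → Unique us
increasing⇒unique {f} = AllPairs.map (λ fu<fw u≡w → <-irrefl (cong f u≡w) fu<fw)

theorem19 : (s t : ℕ) → 1 ≤ s → 1 ≤ t →
    HasCount (Good s t) ((s ∸ 1) * (t ∸ 1) + 1)
theorem19 (suc s′) (suc t′) _ _ =
  goodExtensions (suc s′) (suc t′) ,
  increasing⇒unique (goodExtensions-sorted s′ t′) ,
  (λ v → ⇔-sym good⇔goodForm ⇔-∘ ∈-goodExtensions⇔) ,
  length-goodExtensions (suc s′) (suc t′)
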